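{- Let $q$ be a power of an odd prime and $j,\ell\in\mathbb{F}_q$ with $j+\ell\ne0$. Then for $\mu\in\{1,-1\}$, $$\prod\mathcal{T}_{\ell,j}^{\mu,\mu}=\begin{cases}\mu\left(\frac{2}{q}\right)\left(\frac{j+\ell}{q}\right)\prod\mathcal{T}_{j,\ell}^{\mu,\mu} & \text{if }\left(\frac{j}{q}\right)=\left(\frac{\ell}{q}\right)=\mu,\\ -\mu\left(\frac{2}{q}\right)\left(\frac{j+\ell}{q}\right)\prod\mathcal{T}_{j,\ell}^{\mu,\mu} & \text{otherwise.}\end{cases}$$
   Context: $\mathbb{F}_q$ is the field with $q$ elements. For $a\in\mathbb{F}_q$, $\left(\frac{a}{q}\right)$ is the Legendre symbol ($1$ on nonzero squares, $-1$ on nonsquares, $0$ at $0$). For finite $S\subset\mathbb{F}_q^\times$, $\prod S$ is the product of its elements ($\prod\emptyset=1$). For $j+\ell\ne0$ and $\varepsilon_1,\varepsilon_2\in\{\pm1\}$, $\mathcal{T}_{j,\ell}^{\varepsilon_1,\varepsilon_2}=\{a\in\mathbb{F}_q^\times:\left(\frac{j-a}{q}\right)=\varepsilon_1,\left(\frac{\ell+a}{q}\right)=\varepsilon_2\}$. -}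

module Defs where

open import Level using (0ℓ)
open import Data.Nat as ℕ using (ℕ; zero; suc)
open import Data.Integer as ℤ using (ℤ; +_; -[1+_])
open import Data.List using (List; foldr; filter; length)
open import Data.List.Membership.Propositional using (_∈_)
open import Data.List.Relation.Unary.Unique.Propositional using (Unique)
open import Data.List.Relation.Unary.Any using (Any; any?)
open import Data.Product using (Σ; _×_)
open import Relation.Nullary using (¬_; Dec; yes; no; ¬?; _×-dec_)
open import Relation.Binary.PropositionalEquality using (_≡_)
open import Algebra.Structures using (IsCommutativeRing)

record FiniteField : Set₁ where
  infixl 6 _+_
  infixl 7 _*_
  field
    Carrier  : Set
    _+_ _*_  : Carrier → Carrier → Carrier
    -_       : Carrier → Carrier
    0# 1#    : Carrier
    isCommutativeRing : IsCommutativeRing _≡_ _+_ _*_ -_ 0# 1#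
    0≢1      : ¬ (0# ≡ 1#)
    inverse  : ∀ x → ¬ (x ≡ 0#) → Σ Carrier (λ y → x * y ≡ 1#)
    _≟_      : (x y : Carrier) → Dec (x ≡ y)
    elements : List Carrier
    complete : ∀ x → x ∈ elements
    unique   : Unique elements

  size : ℕ
  size = length elements

  _-_ : Carrier → Carrier → Carrier
  x - y = x + (- y)

  2# : Carrier
  2# = 1# + 1#

  ιℕ : ℕ → Carrier
  ιℕ zero    = 0#
  ιℕ (suc n) = 1# + ιℕ n

  ι : ℤ → Carrier
  ι (+ n)      = ιℕ n
  ι (-[1+ n ]) = - ιℕ (suc n)

  IsSquare : Carrier → Set
  IsSquare a = Any (λ b → b * b ≡ a) elements

  isSquare? : (a : Carrier) → Dec (IsSquare a)
  isSquare? a = any? (λ b → (b * b) ≟ a) elements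

  legendre : Carrier → ℤ
  legendre a with a ≟ 0#
  ... | yes _ = + 0
  ... | no  _ with isSquare? a
  ...   | yes _ = + 1
  ...   | no  _ = ℤ.- (+ 1)

  prod : List Carrier → Carrier
  prod = foldr _*_ 1#

  -- the set T_{j,ℓ}^{ε₁,ε₂}, as the duplicate-free list of its elements
  T : Carrier → Carrier → ℤ → ℤ → List Carrier
  T j ℓ ε₁ ε₂ = filter
    (λ a → ¬? (a ≟ 0#) ×-dec ((legendre (j - a) ℤ.≟ ε₁) ×-dec (legendre (ℓ + a) ℤ.≟ ε₂)))
    elements

-- Replacing a by −a identifies T^{μμ}_{ℓ,j} with −T^{μμ}_{j,ℓ}, so the two products differ by
-- (−1)^{|T^{μμ}_{j,ℓ}|}. Writing a = j − x, that cardinality counts the x ≠ j for which x and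
-- s − x (s = j + ℓ) both have symbol μ. The involution x ↦ s − x pairs these x off except for
-- its fixed point s/2, so the parity is [χ(s/2) = μ] + [χ(j) = χ(ℓ) = μ], and χ(s/2) = χ(2)χ(s).
-- Multiplicativity of χ comes from Euler's criterion, proved by Wilson's argument: pairing x with
-- a/x in the product of the nonzero elements gives a^((q−1)/2) = ±1 according as a is a square.
module Submission where

open import Defs
open import Data.Nat using (ℕ)
open import Data.Nat.Primality using (Prime)
open import Data.Integer as ℤ using (ℤ; +_)
open import Data.Product using (_×_)
open import Data.Sum using (_⊎_)
open import Relation.Nullary using (¬_)
open import Relation.Binary.PropositionalEquality using (_≡_)

open import Level using (0ℓ)
open import Algebra.Bundles using (CommutativeRing; CommutativeSemigroup; Semiring)
open import Algebra.Structures using (IsCommutativeMonoid)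
open import Data.Nat as ℕ using (zero; suc; _≤_; s≤s)
open import Data.Nat.Properties as ℕ using (≤-refl; ≤-trans; n≤1+n)
open import Data.Nat.Divisibility using (_∣_; divides; ∣1⇒≡1)
open import Data.Nat.Primality using (euclidsLemma; prime[2]; prime⇒irreducible)
open import Data.Integer using (-[1+_])
import Data.Integer.Properties as ℤ
open import Data.List using (List; []; _∷_; _++_; map; length; [_]; filter)
open import Data.List.Properties using (length-++; length-map)
open import Data.List.Membership.Propositional using (_∈_; _∉_)
open import Data.List.Membership.Propositional.Properties using (∈-∃++; ∈-++⁺ʳ; ∈-++⁻; ∈-map⁺; ∈-map⁻)
open import Data.List.Membership.Propositional.Properties.WithK using (unique∧set⇒bag)
open import Data.List.Relation.Unary.All as All using (All; []; _∷_)
import Data.List.Relation.Unary.All.Properties as Allₚ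
open import Data.List.Relation.Unary.Any as Any using (here; there)
open import Data.List.Relation.Unary.Unique.Propositional using (Unique)
import Data.List.Relation.Unary.Unique.Propositional.Properties as Uniqueₚ
open import Data.List.Relation.Unary.AllPairs as AllPairs using ([]; _∷_)
open import Data.List.Relation.Binary.BagAndSetEquality using (∼bag⇒↭)
import Data.List.Relation.Binary.Permutation.Propositional as ↭
open ↭ using (_↭_; refl; prep; swap; ↭-refl; ↭-sym; ↭-trans; ↭-prep; ↭⇒↭ₛ; module PermutationReasoning)
open import Data.List.Relation.Binary.Permutation.Propositional.Properties
  using (∈-resp-↭; ↭-length; shift; shifts; ++⁺ˡ)
import Data.List.Relation.Binary.Permutation.Setoid.Properties as SetoidPermutation
open import Data.Product using (∃; _,_; proj₁; proj₂)
open import Data.Sum using (inj₁; inj₂; [_,_]′)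
open import Data.Empty using (⊥-elim)
open import Function.Base using (_∘_)
open import Function.Bundles using (_⇔_; mk⇔; Equivalence)
open import Relation.Nullary using (Dec; yes; no; ¬?; _×-dec_)
open import Relation.Binary.Definitions using (DecidableEquality)
open import Relation.Binary.PropositionalEquality
  using (_≢_; refl; sym; trans; cong; cong₂; subst; setoid; module ≡-Reasoning)

module _ {A : Set} where

  Unique-resp-↭ : {xs ys : List A} → xs ↭ ys → Unique xs → Unique ys
  Unique-resp-↭ p = SetoidPermutation.Unique-resp-↭ (setoid A) (↭⇒↭ₛ p)

  unique∧sameMembers⇒↭ : {xs ys : List A} → Unique xs → Unique ys →
                          (∀ {x} → x ∈ xs ⇔ x ∈ ys) → xs ↭ ys
  unique∧sameMembers⇒↭ u v same = ∼bag⇒↭ (unique∧set⇒bag u v same)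

  Unique-++⁻ˡ : ∀ xs {ys : List A} → Unique (xs ++ ys) → Unique xs
  Unique-++⁻ˡ []       _         = []
  Unique-++⁻ˡ (x ∷ xs) (x∉ ∷ u) = Allₚ.++⁻ˡ xs x∉ ∷ Unique-++⁻ˡ xs u

  Unique-++⇒∉ : ∀ xs {ys : List A} {x} → Unique (xs ++ ys) → x ∈ xs → x ∉ ys
  Unique-++⇒∉ (x ∷ xs) (x∉ ∷ _) (here refl) x∈ys = All.lookup x∉ (∈-++⁺ʳ xs x∈ys) refl
  Unique-++⇒∉ (_ ∷ xs) (_ ∷ u)  (there x∈xs)       = Unique-++⇒∉ xs u x∈xs

module Involution {A : Set} (_≟_ : DecidableEquality A)
                  (τ : A → A) (τ-involutive : ∀ x → τ (τ x) ≡ x) where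

  Closed : List A → Set
  Closed xs = ∀ {x} → x ∈ xs → τ x ∈ xs

  Closed-++⁻ʳ : ∀ xs {ys} → Unique (xs ++ ys) → Closed xs → Closed (xs ++ ys) → Closed ys
  Closed-++⁻ʳ xs u cl-xs cl {y} y∈ys with ∈-++⁻ xs (cl (∈-++⁺ʳ xs y∈ys))
  ... | inj₂ τy∈ys = τy∈ys
  ... | inj₁ τy∈xs =
    ⊥-elim (Unique-++⇒∉ xs u (subst (_∈ xs) (τ-involutive y) (cl-xs τy∈xs)) y∈ys)

  record Split (xs : List A) : Set where
    field
      fixed moved : List A
      ↭-split     : xs ↭ fixed ++ moved ++ map τ moved
      fixed-fixed : All (λ x → τ x ≡ x) fixed
      moved-moved : All (λ x → τ x ≢ x) moved

  Split-resp-↭ : ∀ {xs ys} → xs ↭ ys → Split xs → Split ys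
  Split-resp-↭ p s = record
    { fixed = fixed ; moved = moved ; ↭-split = ↭-trans (↭-sym p) ↭-split
    ; fixed-fixed = fixed-fixed ; moved-moved = moved-moved }
    where open Split s

  Split-fixed∷ : ∀ {x xs} → τ x ≡ x → Split xs → Split (x ∷ xs)
  Split-fixed∷ {x} fix s = record
    { fixed = x ∷ fixed ; moved = moved ; ↭-split = ↭-prep x ↭-split
    ; fixed-fixed = fix ∷ fixed-fixed ; moved-moved = moved-moved }
    where open Split s

  Split-pair∷ : ∀ {x xs} → τ x ≢ x → Split xs → Split (x ∷ τ x ∷ xs)
  Split-pair∷ {x} {xs} mov s = record
    { fixed = fixed ; moved = x ∷ moved ; ↭-split = ↭-pair
    ; fixed-fixed = fixed-fixed ; moved-moved = mov ∷ moved-moved }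
    where
    open Split s
    open PermutationReasoning
    ↭-pair : x ∷ τ x ∷ xs ↭ fixed ++ (x ∷ moved) ++ map τ (x ∷ moved)
    ↭-pair = begin
      x ∷ τ x ∷ xs                            ↭⟨ ↭-prep x (↭-prep (τ x) ↭-split) ⟩
      x ∷ τ x ∷ fixed ++ moved ++ map τ moved ↭⟨ shifts fixed (x ∷ τ x ∷ []) ⟨
      fixed ++ x ∷ τ x ∷ moved ++ map τ moved
        ↭⟨ ++⁺ˡ fixed (↭-prep x (shift (τ x) moved (map τ moved))) ⟨
      fixed ++ x ∷ moved ++ τ x ∷ map τ moved ∎

  module _ {xs} (s : Split xs) where
    open Split s

    length-Split : length xs ≡ length fixed ℕ.+ (length moved ℕ.+ length moved)
    length-Split = begin
      length xs                                      ≡⟨ ↭-length ↭-split ⟩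
      length (fixed ++ moved ++ map τ moved)          ≡⟨ length-++ fixed ⟩
      length fixed ℕ.+ length (moved ++ map τ moved)  ≡⟨ cong (length fixed ℕ.+_) (length-++ moved) ⟩
      length fixed ℕ.+ (length moved ℕ.+ length (map τ moved))
        ≡⟨ cong (λ n → length fixed ℕ.+ (length moved ℕ.+ n)) (length-map τ moved) ⟩
      length fixed ℕ.+ (length moved ℕ.+ length moved) ∎
      where open ≡-Reasoning

    Unique-fixed : Unique xs → Unique fixed
    Unique-fixed u = Unique-++⁻ˡ fixed (Unique-resp-↭ ↭-split u)

    ∈-fixed⁺ : ∀ {x} → x ∈ xs → τ x ≡ x → x ∈ fixed
    ∈-fixed⁺ {x} x∈xs fix with ∈-++⁻ fixed (∈-resp-↭ ↭-split x∈xs)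
    ... | inj₁ x∈fixed = x∈fixed
    ... | inj₂ x∈rest with ∈-++⁻ moved x∈rest
    ...   | inj₁ x∈moved = ⊥-elim (All.lookup moved-moved x∈moved fix)
    ...   | inj₂ x∈τmoved with ∈-map⁻ τ x∈τmoved
    ...     | r , r∈moved , refl =
      ⊥-elim (All.lookup moved-moved r∈moved (trans (sym fix) (τ-involutive r)))

    ∈-fixed⁻ : ∀ {x} → x ∈ fixed → τ x ≡ x
    ∈-fixed⁻ = All.lookup fixed-fixed

  -- Recursion on a length bound, since the partner τ x may sit anywhere in the list.
  split : ∀ {n} xs → length xs ≤ n → Unique xs → Closed xs → Split xs
  split [] _ _ _ = record
    { fixed = [] ; moved = [] ; ↭-split = ↭-refl ; fixed-fixed = [] ; moved-moved = [] }
  split {suc n} (x ∷ xs) (s≤s len) u cl with τ x ≟ x | cl (here refl)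
  ... | yes fix | _          = Split-fixed∷ fix (split xs len (AllPairs.tail u) cl-xs)
    where
    cl-xs : Closed xs
    cl-xs = Closed-++⁻ʳ [ x ] u (λ { (here refl) → here fix }) cl
  ... | no mov  | here τx≡x  = ⊥-elim (mov τx≡x)
  ... | no mov  | there τx∈xs with ∈-∃++ τx∈xs
  ...   | ys , zs , refl = Split-resp-↭ (↭-sym p) (Split-pair∷ mov (split (ys ++ zs) len′ u′ cl′))
    where
    p : x ∷ ys ++ [ τ x ] ++ zs ↭ (x ∷ τ x ∷ []) ++ ys ++ zs
    p = ↭-prep x (shift (τ x) ys zs)
    u-pair : Unique ((x ∷ τ x ∷ []) ++ ys ++ zs)
    u-pair = Unique-resp-↭ p u
    u′ : Unique (ys ++ zs)
    u′ = AllPairs.tail (AllPairs.tail u-pair)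
    cl-pair : Closed (x ∷ τ x ∷ [])
    cl-pair (here refl)         = there (here refl)
    cl-pair (there (here refl)) = here (τ-involutive x)
    cl′ : Closed (ys ++ zs)
    cl′ = Closed-++⁻ʳ (x ∷ τ x ∷ []) u-pair cl-pair
            (λ y∈ → ∈-resp-↭ p (cl (∈-resp-↭ (↭-sym p) y∈)))
    len′ : length (ys ++ zs) ≤ n
    len′ = ≤-trans (n≤1+n _) (subst (_≤ n) (↭-length (shift (τ x) ys zs)) len)

module Products {M : Set} {_∙_ : M → M → M} {ε : M}
                (isCommutativeMonoid : IsCommutativeMonoid _≡_ _∙_ ε) where

  open IsCommutativeMonoid isCommutativeMonoid using (assoc; identityˡ; identityʳ)

  private
    commutativeSemigroup : CommutativeSemigroup 0ℓ 0ℓ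
    commutativeSemigroup = record
      { isCommutativeSemigroup = IsCommutativeMonoid.isCommutativeSemigroup isCommutativeMonoid }

  open import Algebra.Properties.CommutativeSemigroup commutativeSemigroup using (x∙yz≈y∙xz; interchange)
  open ≡-Reasoning

  ∏ : {A : Set} → (A → M) → List A → M
  ∏ f []       = ε
  ∏ f (x ∷ xs) = f x ∙ ∏ f xs

  module _ {A : Set} where

    ∏-↭ : ∀ (f : A → M) {xs ys} → xs ↭ ys → ∏ f xs ≡ ∏ f ys
    ∏-↭ f refl          = refl
    ∏-↭ f (prep x p)    = cong (f x ∙_) (∏-↭ f p)
    ∏-↭ f (swap x y p)  = trans (x∙yz≈y∙xz (f x) (f y) _) (cong (λ t → f y ∙ (f x ∙ t)) (∏-↭ f p))
    ∏-↭ f (↭.trans p q) = trans (∏-↭ f p) (∏-↭ f q)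

    ∏-++ : ∀ (f : A → M) xs {ys} → ∏ f (xs ++ ys) ≡ ∏ f xs ∙ ∏ f ys
    ∏-++ f []       = sym (identityˡ _)
    ∏-++ f (x ∷ xs) = trans (cong (f x ∙_) (∏-++ f xs)) (sym (assoc (f x) _ _))

    ∏-map : ∀ {B : Set} (f : B → M) (g : A → B) xs → ∏ f (map g xs) ≡ ∏ (λ x → f (g x)) xs
    ∏-map f g []       = refl
    ∏-map f g (x ∷ xs) = cong (f (g x) ∙_) (∏-map f g xs)

    ∏-∙ : ∀ (f g : A → M) xs → ∏ (λ x → f x ∙ g x) xs ≡ ∏ f xs ∙ ∏ g xs
    ∏-∙ f g []       = sym (identityˡ ε)
    ∏-∙ f g (x ∷ xs) = trans (cong ((f x ∙ g x) ∙_) (∏-∙ f g xs)) (interchange (f x) (g x) _ _)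

    ∏-cong : ∀ {f g : A → M} xs → (∀ {x} → x ∈ xs → f x ≡ g x) → ∏ f xs ≡ ∏ g xs
    ∏-cong []       eq = refl
    ∏-cong (x ∷ xs) eq = cong₂ _∙_ (eq (here refl)) (∏-cong xs (eq ∘ there))

    ∏-ε : ∀ {f : A → M} xs → (∀ {x} → x ∈ xs → f x ≡ ε) → ∏ f xs ≡ ε
    ∏-ε []       eq = refl
    ∏-ε (x ∷ xs) eq = trans (cong₂ _∙_ (eq (here refl)) (∏-ε xs (eq ∘ there))) (identityˡ ε)

    ∏-point : ∀ (f : A → M) {xs y} → Unique xs → y ∈ xs → (∀ {x} → x ≢ y → f x ≡ ε) → ∏ f xs ≡ f y
    ∏-point f {x ∷ xs} (x∉ ∷ _) (here refl) rest = begin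
      f x ∙ ∏ f xs ≡⟨ cong (f x ∙_) (∏-ε xs (λ x′∈ → rest (λ { refl → All.lookup x∉ x′∈ refl }))) ⟩
      f x ∙ ε      ≡⟨ identityʳ (f x) ⟩
      f x          ∎
    ∏-point f {x ∷ xs} {y} (x∉ ∷ u) (there y∈xs) rest = begin
      f x ∙ ∏ f xs ≡⟨ cong (_∙ ∏ f xs) (rest (λ { refl → All.lookup x∉ y∈xs refl })) ⟩
      ε ∙ ∏ f xs   ≡⟨ identityˡ (∏ f xs) ⟩
      ∏ f xs       ≡⟨ ∏-point f u y∈xs rest ⟩
      f y          ∎

    module _ {τ : A → A} (_≟_ : DecidableEquality A) (τ-involutive : ∀ x → τ (τ x) ≡ x) where
      open Involution _≟_ τ τ-involutive

      ∏-Split : ∀ (f : A → M) {xs} (s : Split xs) →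
                ∏ f xs ≡ ∏ f (Split.fixed s) ∙ ∏ (λ x → f x ∙ f (τ x)) (Split.moved s)
      ∏-Split f {xs} s = begin
        ∏ f xs                                              ≡⟨ ∏-↭ f ↭-split ⟩
        ∏ f (fixed ++ moved ++ map τ moved)                 ≡⟨ ∏-++ f fixed ⟩
        ∏ f fixed ∙ ∏ f (moved ++ map τ moved)              ≡⟨ cong (∏ f fixed ∙_) (∏-++ f moved) ⟩
        ∏ f fixed ∙ (∏ f moved ∙ ∏ f (map τ moved))
          ≡⟨ cong (λ t → ∏ f fixed ∙ (∏ f moved ∙ t)) (∏-map f τ moved) ⟩
        ∏ f fixed ∙ (∏ f moved ∙ ∏ (λ x → f (τ x)) moved)
          ≡⟨ cong (∏ f fixed ∙_) (∏-∙ f (λ x → f (τ x)) moved) ⟨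
        ∏ f fixed ∙ ∏ (λ x → f x ∙ f (τ x)) moved           ∎
        where open Split s

IsSign : ℤ → Set
IsSign z = z ≡ + 1 ⊎ z ≡ ℤ.- (+ 1)

IsSign-* : ∀ {x y} → IsSign x → IsSign y → IsSign (x ℤ.* y)
IsSign-* (inj₁ refl) (inj₁ refl) = inj₁ refl
IsSign-* (inj₁ refl) (inj₂ refl) = inj₂ refl
IsSign-* (inj₂ refl) (inj₁ refl) = inj₂ refl
IsSign-* (inj₂ refl) (inj₂ refl) = inj₁ refl

IsSign-square : ∀ {x} → IsSign x → x ℤ.* x ≡ + 1
IsSign-square (inj₁ refl) = refl
IsSign-square (inj₂ refl) = refl

module FiniteFieldProperties (F : FiniteField) where
  open FiniteField F

  commutativeRing : CommutativeRing 0ℓ 0ℓ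
  commutativeRing = record { isCommutativeRing = isCommutativeRing }

  open CommutativeRing commutativeRing
    using ( +-assoc; +-comm; +-identityʳ; -‿inverseʳ; *-assoc; *-comm
          ; *-identityˡ; *-identityʳ; distribˡ; distribʳ; zeroˡ; zeroʳ; ring; +-abelianGroup
          ; *-isCommutativeMonoid; semiring; commutativeSemiring)
  open import Algebra.Definitions.RawSemiring (Semiring.rawSemiring semiring) using (_^_)
  open import Algebra.Properties.CommutativeSemiring.Exp commutativeSemiring using (^-distrib-*)
  open import Algebra.Properties.Monoid.Mult (CommutativeRing.*-monoid commutativeRing) using (×-idem)
  open import Algebra.Properties.Ring ring using (-‿distribˡ-*; -‿distribʳ-*; -1*x≈-x)
  open import Algebra.Properties.AbelianGroup +-abelianGroup
    using (ε⁻¹≈ε; ⁻¹-involutive; ⁻¹-injective; inverseˡ-unique; x∙y⁻¹≈ε⇒x≈y; x≈y⇒x∙y⁻¹≈ε;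
           //-rightDividesˡ; xyx⁻¹≈y; ⁻¹-anti-homo‿-)
  open import Algebra.Properties.CommutativeSemigroup
    (CommutativeRing.*-commutativeSemigroup commutativeRing) using (x∙yz≈y∙xz)
  open Products *-isCommutativeMonoid public
  open ≡-Reasoning

  x-[x-y]≡y : ∀ x y → x - (x - y) ≡ y
  x-[x-y]≡y x y = begin
    x + - (x - y) ≡⟨ cong (λ t → x + t) (⁻¹-anti-homo‿- x y) ⟩
    x + (y - x)   ≡⟨ +-assoc x y (- x) ⟨
    (x + y) - x   ≡⟨ xyx⁻¹≈y x y ⟩
    y             ∎

  x+[y-z]≡[y+x]-z : ∀ x y z → x + (y - z) ≡ (y + x) - z
  x+[y-z]≡[y+x]-z x y z = trans (sym (+-assoc x y (- z))) (cong (_- z) (+-comm x y))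

  [x+y]-x≡y : ∀ x y → (x + y) - x ≡ y
  [x+y]-x≡y = xyx⁻¹≈y

  x-y≡0⇔x≡y : ∀ {x y} → x - y ≡ 0# ⇔ x ≡ y
  x-y≡0⇔x≡y {x} {y} = mk⇔ (x∙y⁻¹≈ε⇒x≈y x y) x≈y⇒x∙y⁻¹≈ε

  -x≡0⇔x≡0 : ∀ {x} → - x ≡ 0# ⇔ x ≡ 0#
  -x≡0⇔x≡0 = mk⇔ (λ -x≡0 → ⁻¹-injective (trans -x≡0 (sym ε⁻¹≈ε))) (λ { refl → ε⁻¹≈ε })

  -‿involutive : ∀ x → - (- x) ≡ x
  -‿involutive = ⁻¹-involutive

  x+x≡2x : ∀ x → x + x ≡ 2# * x
  x+x≡2x x = trans (sym (cong₂ _+_ (*-identityˡ x) (*-identityˡ x))) (sym (distribʳ x 1# 1#))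

  -x*-y≡x*y : ∀ x y → - x * - y ≡ x * y
  -x*-y≡x*y x y = begin
    - x * - y     ≡⟨ -‿distribˡ-* x (- y) ⟨
    - (x * - y)   ≡⟨ cong -_ (-‿distribʳ-* x y) ⟨
    - (- (x * y)) ≡⟨ ⁻¹-involutive (x * y) ⟩
    x * y         ∎

  1≢0 : 1# ≢ 0#
  1≢0 = 0≢1 ∘ sym

  infix 8 _⁻¹
  _⁻¹ : Carrier → Carrier
  x ⁻¹ with x ≟ 0#
  ... | yes _   = 0#
  ... | no x≢0 = proj₁ (inverse x x≢0)

  0⁻¹≡0 : 0# ⁻¹ ≡ 0#
  0⁻¹≡0 with 0# ≟ 0#
  ... | yes _   = refl
  ... | no 0≢0 = ⊥-elim (0≢0 refl)

  x*x⁻¹≡1 : ∀ {x} → x ≢ 0# → x * x ⁻¹ ≡ 1#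
  x*x⁻¹≡1 {x} x≢0 with x ≟ 0#
  ... | yes x≡0 = ⊥-elim (x≢0 x≡0)
  ... | no x≢0′ = proj₂ (inverse x x≢0′)

  x⁻¹≢0 : ∀ {x} → x ≢ 0# → x ⁻¹ ≢ 0#
  x⁻¹≢0 {x} x≢0 x⁻¹≡0 = 1≢0 (trans (sym (x*x⁻¹≡1 x≢0)) (trans (cong (x *_) x⁻¹≡0) (zeroʳ x)))

  x*[y*x⁻¹]≡y : ∀ {x} y → x ≢ 0# → x * (y * x ⁻¹) ≡ y
  x*[y*x⁻¹]≡y {x} y x≢0 = begin
    x * (y * x ⁻¹) ≡⟨ x∙yz≈y∙xz x y (x ⁻¹) ⟩
    y * (x * x ⁻¹) ≡⟨ cong (y *_) (x*x⁻¹≡1 x≢0) ⟩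
    y * 1#         ≡⟨ *-identityʳ y ⟩
    y              ∎

  x*y≡z⇒z*x⁻¹≡y : ∀ {x y z} → x ≢ 0# → x * y ≡ z → z * x ⁻¹ ≡ y
  x*y≡z⇒z*x⁻¹≡y {x} {y} x≢0 refl = begin
    (x * y) * x ⁻¹ ≡⟨ *-comm (x * y) (x ⁻¹) ⟩
    x ⁻¹ * (x * y) ≡⟨ *-assoc (x ⁻¹) x y ⟨
    x ⁻¹ * x * y   ≡⟨ cong (_* y) (trans (*-comm (x ⁻¹) x) (x*x⁻¹≡1 x≢0)) ⟩
    1# * y         ≡⟨ *-identityˡ y ⟩
    y              ∎

  x*y≡0⇒x≡0⊎y≡0 : ∀ {x y} → x * y ≡ 0# → x ≡ 0# ⊎ y ≡ 0#
  x*y≡0⇒x≡0⊎y≡0 {x} {y} xy≡0 with x ≟ 0#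
  ... | yes x≡0 = inj₁ x≡0
  ... | no x≢0  = inj₂ (trans (sym (x*y≡z⇒z*x⁻¹≡y x≢0 xy≡0)) (zeroˡ (x ⁻¹)))

  x*y≢0⇒y≢0 : ∀ {x y} → x * y ≢ 0# → y ≢ 0#
  x*y≢0⇒y≢0 {x} xy≢0 refl = xy≢0 (zeroʳ x)

  square-roots : ∀ {y b} → y * y ≡ b * b → y ≡ b ⊎ y ≡ - b
  square-roots {y} {b} yy≡bb with x*y≡0⇒x≡0⊎y≡0 difference≡0
    where
    difference≡0 : (y - b) * (y + b) ≡ 0#
    difference≡0 = begin
      (y - b) * (y + b)                 ≡⟨ distribʳ (y + b) y (- b) ⟩
      y * (y + b) + - b * (y + b)       ≡⟨ cong₂ _+_ (distribˡ y y b) (sym (-‿distribˡ-* b (y + b))) ⟩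
      (y * y + y * b) - (b * (y + b))   ≡⟨ cong (λ t → (y * y + y * b) - t) (distribˡ b y b) ⟩
      (y * y + y * b) - (b * y + b * b) ≡⟨ cong₂ (λ u v → (u + y * b) - (v + b * b)) yy≡bb (*-comm b y) ⟩
      (b * b + y * b) - (y * b + b * b) ≡⟨ cong (λ t → t - (y * b + b * b)) (+-comm (b * b) (y * b)) ⟩
      (y * b + b * b) - (y * b + b * b) ≡⟨ -‿inverseʳ (y * b + b * b) ⟩
      0#                                ∎
  ... | inj₁ y-b≡0 = inj₁ (x∙y⁻¹≈ε⇒x≈y y b y-b≡0)
  ... | inj₂ y+b≡0 = inj₂ (inverseˡ-unique y b y+b≡0)

  -- ∏ (sign ∘ P?) xs is (−1) to the number of elements of xs satisfying P.
  sign : ∀ {P : Set} → Dec P → Carrier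
  sign (yes _) = - 1#
  sign (no _)  = 1#

  select : ∀ {P : Set} → Dec P → Carrier → Carrier
  select (yes _) x = x
  select (no _)  _ = 1#

  sign² : ∀ {P : Set} (p : Dec P) → sign p * sign p ≡ 1#
  sign² (yes _) = trans (-x*-y≡x*y 1# 1#) (*-identityˡ 1#)
  sign² (no _)  = *-identityˡ 1#

  module _ {P Q : Set} where

    sign-cong : P ⇔ Q → (p : Dec P) (q : Dec Q) → sign p ≡ sign q
    sign-cong _   (yes _) (yes _) = refl
    sign-cong _   (no _)  (no _)  = refl
    sign-cong P⇔Q (yes p) (no ¬q) = ⊥-elim (¬q (Equivalence.to P⇔Q p))
    sign-cong P⇔Q (no ¬p) (yes q) = ⊥-elim (¬p (Equivalence.from P⇔Q q))

    select-neg : P ⇔ Q → (p : Dec P) (q : Dec Q) → ∀ x → select p (- x) ≡ sign q * select q x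
    select-neg _   (yes _) (yes _) x = sym (-1*x≈-x x)
    select-neg _   (no _)  (no _)  x = sym (*-identityˡ 1#)
    select-neg P⇔Q (yes p) (no ¬q) x = ⊥-elim (¬q (Equivalence.to P⇔Q p))
    select-neg P⇔Q (no ¬p) (yes q) x = ⊥-elim (¬p (Equivalence.from P⇔Q q))

    sign-¬×-dec : (p : Dec P) (q : Dec Q) → sign (¬? p ×-dec q) ≡ sign q * sign (p ×-dec q)
    sign-¬×-dec (yes _) q@(yes _) = sym (sign² q)
    sign-¬×-dec (yes _) (no _)  = sym (*-identityˡ 1#)
    sign-¬×-dec (no _)  (yes _) = sym (*-identityʳ (- 1#))
    sign-¬×-dec (no _)  (no _)  = sym (*-identityˡ 1#)

  select-yes : ∀ {P : Set} → P → (p : Dec P) → ∀ x → select p x ≡ x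
  select-yes _  (yes _) _ = refl
  select-yes pr (no ¬p) _ = ⊥-elim (¬p pr)

  select-no : ∀ {P : Set} → ¬ P → (p : Dec P) → ∀ x → select p x ≡ 1#
  select-no ¬p (yes p) _ = ⊥-elim (¬p p)
  select-no _  (no _)  _ = refl

  sign-yes : ∀ {P : Set} → P → (p : Dec P) → sign p ≡ - 1#
  sign-yes _  (yes _) = refl
  sign-yes pr (no ¬p) = ⊥-elim (¬p pr)

  sign-no : ∀ {P : Set} → ¬ P → (p : Dec P) → sign p ≡ 1#
  sign-no ¬p (yes p) = ⊥-elim (¬p p)
  sign-no _  (no _)  = refl

  prod-filter : ∀ {P : Carrier → Set} (P? : ∀ x → Dec (P x)) xs →
                prod (filter P? xs) ≡ ∏ (λ x → select (P? x) x) xs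
  prod-filter P? []       = refl
  prod-filter P? (x ∷ xs) with P? x
  ... | yes _ = cong (x *_) (prod-filter P? xs)
  ... | no _  = trans (prod-filter P? xs) (sym (*-identityˡ _))

  module ElementsInvolution (τ : Carrier → Carrier) (τ-involutive : ∀ x → τ (τ x) ≡ x) where
    open Involution _≟_ τ τ-involutive

    elementsSplit : Split elements
    elementsSplit = split elements ≤-refl unique (λ {x} _ → complete (τ x))

    open Split elementsSplit public using (fixed; moved; moved-moved)

    fixed↭ : ∀ {ys} → Unique ys → (∀ {y} → y ∈ ys ⇔ τ y ≡ y) → fixed ↭ ys
    fixed↭ u ∈ys⇔fixed = unique∧sameMembers⇒↭ (Unique-fixed elementsSplit unique) u
      (mk⇔ (Equivalence.from ∈ys⇔fixed ∘ ∈-fixed⁻ elementsSplit)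
           (∈-fixed⁺ elementsSplit (complete _) ∘ Equivalence.to ∈ys⇔fixed))

    size-split : ∀ {ys} → fixed ↭ ys → size ≡ length ys ℕ.+ (length moved ℕ.+ length moved)
    size-split fixed↭ys = trans (length-Split elementsSplit)
                                (cong (ℕ._+ (length moved ℕ.+ length moved)) (↭-length fixed↭ys))

    ∏-elements : ∀ f → ∏ f elements ≡ ∏ f fixed * ∏ (λ x → f x * f (τ x)) moved
    ∏-elements f = ∏-Split _≟_ τ-involutive f elementsSplit

    ∏-reindex : ∀ f → ∏ f elements ≡ ∏ (f ∘ τ) elements
    ∏-reindex f = trans (∏-↭ f (↭-sym map-τ-elements↭)) (∏-map f τ elements)
      where
      τ-injective : ∀ {x y} → τ x ≡ τ y → x ≡ y
      τ-injective {x} {y} e = trans (sym (τ-involutive x)) (trans (cong τ e) (τ-involutive y))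
      map-τ-elements↭ : map τ elements ↭ elements
      map-τ-elements↭ = unique∧sameMembers⇒↭ (Uniqueₚ.map⁺ τ-injective unique) unique
        (λ {x} → mk⇔ (λ _ → complete x)
                     (λ _ → subst (_∈ map τ elements) (τ-involutive x) (∈-map⁺ τ (complete (τ x)))))

  ∏-sign-involution : ∀ {P : Carrier → Set} (P? : ∀ x → Dec (P x))
    (τ : Carrier → Carrier) (τ-involutive : ∀ x → τ (τ x) ≡ x) {h} →
    (∀ x → P (τ x) ⇔ P x) → (∀ {x} → τ x ≡ x ⇔ x ≡ h) →
    ∏ (sign ∘ P?) elements ≡ sign (P? h)
  ∏-sign-involution P? τ τ-involutive {h} P-invariant fixed⇔h = begin
    ∏ (sign ∘ P?) elements
      ≡⟨ ∏-elements (sign ∘ P?) ⟩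
    ∏ (sign ∘ P?) fixed * ∏ (λ x → sign (P? x) * sign (P? (τ x))) moved
      ≡⟨ cong₂ _*_ (∏-↭ (sign ∘ P?) fixed↭[h]) (∏-ε moved pairs) ⟩
    (sign (P? h) * 1#) * 1#    ≡⟨ *-identityʳ _ ⟩
    sign (P? h) * 1#           ≡⟨ *-identityʳ _ ⟩
    sign (P? h)                ∎
    where
    open ElementsInvolution τ τ-involutive
    fixed↭[h] : fixed ↭ h ∷ []
    fixed↭[h] = fixed↭ ([] ∷ [])
      (mk⇔ (λ { (here y≡h) → Equivalence.from fixed⇔h y≡h ; (there ()) })
           (here ∘ Equivalence.to fixed⇔h))
    pairs : ∀ {x} → x ∈ moved → sign (P? x) * sign (P? (τ x)) ≡ 1#
    pairs {x} _ = begin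
      sign (P? x) * sign (P? (τ x))
        ≡⟨ cong (sign (P? x) *_) (sign-cong (P-invariant x) (P? (τ x)) (P? x)) ⟩
      sign (P? x) * sign (P? x)     ≡⟨ sign² (P? x) ⟩
      1#                            ∎

  ∏-sign-without : ∀ {P : Carrier → Set} (P? : ∀ x → Dec (P x)) y →
    ∏ (λ x → sign (¬? (x ≟ y) ×-dec P? x)) elements ≡ ∏ (sign ∘ P?) elements * sign (P? y)
  ∏-sign-without P? y = begin
    ∏ (λ x → sign (¬? (x ≟ y) ×-dec P? x)) elements
      ≡⟨ ∏-cong elements (λ {x} _ → sign-¬×-dec (x ≟ y) (P? x)) ⟩
    ∏ (λ x → sign (P? x) * sign ((x ≟ y) ×-dec P? x)) elements
      ≡⟨ ∏-∙ (sign ∘ P?) (λ x → sign ((x ≟ y) ×-dec P? x)) elements ⟩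
    ∏ (sign ∘ P?) elements * ∏ (λ x → sign ((x ≟ y) ×-dec P? x)) elements
      ≡⟨ cong (∏ (sign ∘ P?) elements *_) at-y ⟩
    ∏ (sign ∘ P?) elements * sign (P? y) ∎
    where
    at-y : ∏ (λ x → sign ((x ≟ y) ×-dec P? x)) elements ≡ sign (P? y)
    at-y = trans (∏-point _ unique (complete y) (λ {x} x≢y → sign-no (x≢y ∘ proj₁) ((x ≟ y) ×-dec P? x)))
                 (sign-cong (mk⇔ proj₂ (refl ,_)) ((y ≟ y) ×-dec P? y) (P? y))

  prod-filter-neg : ∀ {P Q : Carrier → Set} (P? : ∀ x → Dec (P x)) (Q? : ∀ x → Dec (Q x)) →
    (∀ x → P (- x) ⇔ Q x) →
    prod (filter P? elements) ≡ ∏ (sign ∘ Q?) elements * prod (filter Q? elements)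
  prod-filter-neg P? Q? P-⇔Q = begin
    prod (filter P? elements)                  ≡⟨ prod-filter P? elements ⟩
    ∏ (λ x → select (P? x) x) elements         ≡⟨ ElementsInvolution.∏-reindex -_ -‿involutive _ ⟩
    ∏ (λ x → select (P? (- x)) (- x)) elements
      ≡⟨ ∏-cong elements (λ {x} _ → select-neg (P-⇔Q x) (P? (- x)) (Q? x) x) ⟩
    ∏ (λ x → sign (Q? x) * select (Q? x) x) elements  ≡⟨ ∏-∙ (sign ∘ Q?) _ elements ⟩
    ∏ (sign ∘ Q?) elements * ∏ (λ x → select (Q? x) x) elements
      ≡⟨ cong (∏ (sign ∘ Q?) elements *_) (prod-filter Q? elements) ⟨
    ∏ (sign ∘ Q?) elements * prod (filter Q? elements) ∎

  2≡0⇒2∣size : 2# ≡ 0# → 2 ∣ size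
  2≡0⇒2∣size 2≡0 = divides (length moved) (begin
    size                          ≡⟨ size-split (fixed↭ [] no-fixed-point) ⟩
    length moved ℕ.+ length moved ≡⟨ cong (length moved ℕ.+_) (ℕ.+-identityʳ _) ⟨
    2 ℕ.* length moved            ≡⟨ ℕ.*-comm 2 (length moved) ⟩
    length moved ℕ.* 2            ∎)
    where
    +1-involutive : ∀ x → x + 1# + 1# ≡ x
    +1-involutive x = trans (+-assoc x 1# 1#) (trans (cong (λ t → x + t) 2≡0) (+-identityʳ x))
    open ElementsInvolution (_+ 1#) +1-involutive
    no-fixed-point : ∀ {y} → y ∈ [] ⇔ y + 1# ≡ y
    no-fixed-point {y} = mk⇔ (λ ()) (λ y+1≡y → ⊥-elim (0≢1 (begin
      0#             ≡⟨ -‿inverseʳ y ⟨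
      y - y          ≡⟨ cong (_- y) y+1≡y ⟨
      (y + 1#) - y   ≡⟨ xyx⁻¹≈y y 1# ⟩
      1#             ∎)))

  ∏-const : ∀ {A : Set} a (xs : List A) → ∏ (λ _ → a) xs ≡ a ^ length xs
  ∏-const a []       = refl
  ∏-const a (_ ∷ xs) = cong (a *_) (∏-const a xs)

  x*y≢0 : ∀ {x y} → x ≢ 0# → y ≢ 0# → x * y ≢ 0#
  x*y≢0 x≢0 y≢0 xy≡0 = [ x≢0 , y≢0 ]′ (x*y≡0⇒x≡0⊎y≡0 xy≡0)

  -- The Legendre symbol

  IsSquare-intro : ∀ {a} b → b * b ≡ a → IsSquare a
  IsSquare-intro b bb≡a = Any.map (λ { refl → bb≡a }) (complete b)

  legendre-square : ∀ {a} → a ≢ 0# → IsSquare a → legendre a ≡ + 1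
  legendre-square {a} a≢0 sq with a ≟ 0#
  ... | yes a≡0 = ⊥-elim (a≢0 a≡0)
  ... | no _ with isSquare? a
  ...   | yes _   = refl
  ...   | no ¬sq = ⊥-elim (¬sq sq)

  legendre-¬square : ∀ {a} → a ≢ 0# → ¬ IsSquare a → legendre a ≡ ℤ.- (+ 1)
  legendre-¬square {a} a≢0 ¬sq with a ≟ 0#
  ... | yes a≡0 = ⊥-elim (a≢0 a≡0)
  ... | no _ with isSquare? a
  ...   | yes sq = ⊥-elim (¬sq sq)
  ...   | no _   = refl

  legendre-sign : ∀ {a} → a ≢ 0# → IsSign (legendre a)
  legendre-sign {a} a≢0 with isSquare? a
  ... | yes sq = inj₁ (legendre-square a≢0 sq)
  ... | no ¬sq = inj₂ (legendre-¬square a≢0 ¬sq)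

  ι-+1 : ι (+ 1) ≡ 1#
  ι-+1 = +-identityʳ 1#

  ι-neg : ∀ z → ι (ℤ.- z) ≡ - ι z
  ι-neg (+ zero)  = sym ε⁻¹≈ε
  ι-neg (+ suc n) = refl
  ι-neg -[1+ n ]  = sym (⁻¹-involutive _)

  ι-*-sign : ∀ {x y} → IsSign x → IsSign y → ι (x ℤ.* y) ≡ ι x * ι y
  ι-*-sign (inj₁ refl) (inj₁ refl) = sym (trans (cong (_* ι (+ 1)) ι-+1) (*-identityˡ _))
  ι-*-sign (inj₁ refl) (inj₂ refl) = sym (trans (cong (_* ι (ℤ.- (+ 1))) ι-+1) (*-identityˡ _))
  ι-*-sign (inj₂ refl) (inj₁ refl) = sym (trans (cong (ι (ℤ.- (+ 1)) *_) ι-+1) (*-identityʳ _))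
  ι-*-sign (inj₂ refl) (inj₂ refl) = begin
    ι (+ 1)                     ≡⟨ ι-+1 ⟩
    1#                          ≡⟨ *-identityˡ 1# ⟨
    1# * 1#                     ≡⟨ cong₂ _*_ ι-+1 ι-+1 ⟨
    ι (+ 1) * ι (+ 1)           ≡⟨ -x*-y≡x*y (ι (+ 1)) (ι (+ 1)) ⟨
    - ι (+ 1) * - ι (+ 1)       ∎

  sign-≟ : ∀ {m x} → IsSign m → IsSign x → sign (x ℤ.≟ m) ≡ - ι (m ℤ.* x)
  sign-≟ (inj₁ refl) (inj₁ refl) = cong -_ (sym ι-+1)
  sign-≟ (inj₁ refl) (inj₂ refl) = sym (trans (⁻¹-involutive _) ι-+1)
  sign-≟ (inj₂ refl) (inj₁ refl) = sym (trans (⁻¹-involutive _) ι-+1)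
  sign-≟ (inj₂ refl) (inj₂ refl) = cong -_ (sym ι-+1)

  -- Odd characteristic: Wilson's product and Euler's criterion

  module OddCharacteristic (2≢0 : 2# ≢ 0#) where

    x≢-x : ∀ {x} → x ≢ 0# → x ≢ - x
    x≢-x {x} x≢0 x≡-x = x*y≢0 2≢0 x≢0 (begin
      2# * x ≡⟨ x+x≡2x x ⟨
      x + x  ≡⟨ cong (λ t → x + t) x≡-x ⟩
      x - x  ≡⟨ -‿inverseʳ x ⟩
      0#     ∎)

    ι-injective-sign : ∀ {x y} → IsSign x → IsSign y → ι x ≡ ι y → x ≡ y
    ι-injective-sign (inj₁ refl) (inj₁ refl) _  = refl
    ι-injective-sign (inj₂ refl) (inj₂ refl) _  = refl
    ι-injective-sign (inj₁ refl) (inj₂ refl) eq =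
      ⊥-elim (x≢-x 1≢0 (trans (sym ι-+1) (trans eq (cong -_ ι-+1))))
    ι-injective-sign (inj₂ refl) (inj₁ refl) eq =
      ⊥-elim (x≢-x 1≢0 (trans (sym ι-+1) (trans (sym eq) (cong -_ ι-+1))))

    x-y≡y⇔y≡x*2⁻¹ : ∀ {x y} → x - y ≡ y ⇔ y ≡ x * 2# ⁻¹
    x-y≡y⇔y≡x*2⁻¹ {x} {y} = mk⇔ to from
      where
      to : x - y ≡ y → y ≡ x * 2# ⁻¹
      to x-y≡y = sym (x*y≡z⇒z*x⁻¹≡y 2≢0 (begin
        2# * y        ≡⟨ x+x≡2x y ⟨
        y + y         ≡⟨ cong (_+ y) x-y≡y ⟨
        (x - y) + y   ≡⟨ //-rightDividesˡ y x ⟩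
        x             ∎))
      from : y ≡ x * 2# ⁻¹ → x - y ≡ y
      from refl = begin
        x - y         ≡⟨ cong (_- y) (trans (sym (x*[y*x⁻¹]≡y x 2≢0)) (sym (x+x≡2x y))) ⟩
        (y + y) - y   ≡⟨ [x+y]-x≡y y y ⟩
        y             ∎

    unit : Carrier → Carrier
    unit x = select (¬? (x ≟ 0#)) x

    wilsonProduct : Carrier
    wilsonProduct = prod (filter (λ x → ¬? (x ≟ 0#)) elements)

    module Inversion {a} (a≢0 : a ≢ 0#) where

      τ : Carrier → Carrier
      τ x = a * x ⁻¹

      τ0≡0 : τ 0# ≡ 0#
      τ0≡0 = trans (cong (a *_) 0⁻¹≡0) (zeroʳ a)

      x*τx≡a : ∀ {x} → x ≢ 0# → x * τ x ≡ a
      x*τx≡a = x*[y*x⁻¹]≡y a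

      τx≢0 : ∀ {x} → x ≢ 0# → τ x ≢ 0#
      τx≢0 x≢0 = x*y≢0⇒y≢0 (λ e → a≢0 (trans (sym (x*τx≡a x≢0)) e))

      τ-involutive : ∀ x → τ (τ x) ≡ x
      τ-involutive x = by-cases (x ≟ 0#)
        where
        by-cases : Dec (x ≡ 0#) → τ (τ x) ≡ x
        by-cases (yes refl) = trans (cong τ τ0≡0) τ0≡0
        by-cases (no x≢0)   = x*y≡z⇒z*x⁻¹≡y (τx≢0 x≢0) (trans (*-comm (τ x) x) (x*τx≡a x≢0))

      τ-fixed⇔ : ∀ {x} → τ x ≡ x ⇔ (x ≡ 0# ⊎ x * x ≡ a)
      τ-fixed⇔ {x} = mk⇔ to from
        where
        to : τ x ≡ x → x ≡ 0# ⊎ x * x ≡ a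
        to τx≡x = by-cases (x ≟ 0#)
          where
          by-cases : Dec (x ≡ 0#) → x ≡ 0# ⊎ x * x ≡ a
          by-cases (yes x≡0) = inj₁ x≡0
          by-cases (no x≢0)  = inj₂ (trans (cong (x *_) (sym τx≡x)) (x*τx≡a x≢0))
        from : x ≡ 0# ⊎ x * x ≡ a → τ x ≡ x
        from (inj₁ refl) = τ0≡0
        from (inj₂ xx≡a) = x*y≡z⇒z*x⁻¹≡y x≢0 xx≡a
          where
          x≢0 : x ≢ 0#
          x≢0 refl = a≢0 (trans (sym xx≡a) (zeroˡ 0#))

      open ElementsInvolution τ τ-involutive

      wilson-split : wilsonProduct ≡ ∏ unit fixed * a ^ length moved
      wilson-split = begin
        wilsonProduct                                      ≡⟨ prod-filter _ elements ⟩
        ∏ unit elements                                    ≡⟨ ∏-elements unit ⟩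
        ∏ unit fixed * ∏ (λ x → unit x * unit (τ x)) moved
          ≡⟨ cong (∏ unit fixed *_) (∏-cong moved pair) ⟩
        ∏ unit fixed * ∏ (λ _ → a) moved                   ≡⟨ cong (∏ unit fixed *_) (∏-const a moved) ⟩
        ∏ unit fixed * a ^ length moved                    ∎
        where
        pair : ∀ {x} → x ∈ moved → unit x * unit (τ x) ≡ a
        pair {x} x∈moved = begin
          unit x * unit (τ x)
            ≡⟨ cong₂ _*_ (select-yes x≢0 (¬? (x ≟ 0#)) x) (select-yes (τx≢0 x≢0) (¬? (τ x ≟ 0#)) (τ x)) ⟩
          x * τ x             ≡⟨ x*τx≡a x≢0 ⟩
          a                   ∎
          where
          x≢0 : x ≢ 0#
          x≢0 refl = All.lookup moved-moved x∈moved τ0≡0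

      wilson-¬square : ¬ IsSquare a → ∃ λ m → size ≡ suc (m ℕ.+ m) × wilsonProduct ≡ a ^ m
      wilson-¬square ¬sq = length moved , size≡ , (begin
        wilsonProduct                   ≡⟨ wilson-split ⟩
        ∏ unit fixed * a ^ length moved
          ≡⟨ cong (_* a ^ length moved) (trans (∏-↭ unit fixed↭[0]) ∏unit[0]≡1) ⟩
        1# * a ^ length moved           ≡⟨ *-identityˡ _ ⟩
        a ^ length moved                ∎)
        where
        fixed↭[0] : fixed ↭ 0# ∷ []
        fixed↭[0] = fixed↭ ([] ∷ []) (λ {y} → mk⇔
          (λ { (here refl) → τ0≡0 ; (there ()) })
          (λ τy≡y → [ here , (λ yy≡a → ⊥-elim (¬sq (IsSquare-intro y yy≡a))) ]′
                      (Equivalence.to τ-fixed⇔ τy≡y)))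
        ∏unit[0]≡1 : ∏ unit (0# ∷ []) ≡ 1#
        ∏unit[0]≡1 = trans (*-identityʳ _) (select-no (λ 0≢0 → 0≢0 refl) (¬? (0# ≟ 0#)) 0#)
        size≡ : size ≡ suc (length moved ℕ.+ length moved)
        size≡ = size-split fixed↭[0]

      wilson-square : ∀ {b} → b * b ≡ a →
                      ∃ λ m → size ≡ suc (suc m ℕ.+ suc m) × wilsonProduct ≡ - (a ^ suc m)
      wilson-square {b} bb≡a = length moved , size≡ , (begin
        wilsonProduct                   ≡⟨ wilson-split ⟩
        ∏ unit fixed * a ^ length moved
          ≡⟨ cong (_* a ^ length moved) (trans (∏-↭ unit fixed↭[0,b,-b]) ∏unit≡-a) ⟩
        - a * a ^ length moved          ≡⟨ -‿distribˡ-* a _ ⟨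
        - (a ^ suc (length moved))      ∎)
        where
        b≢0 : b ≢ 0#
        b≢0 refl = a≢0 (trans (sym bb≡a) (zeroˡ 0#))
        -b≢0 : - b ≢ 0#
        -b≢0 = b≢0 ∘ Equivalence.to -x≡0⇔x≡0
        fixed↭[0,b,-b] : fixed ↭ 0# ∷ b ∷ - b ∷ []
        fixed↭[0,b,-b] = fixed↭
          ((b≢0 ∘ sym ∷ -b≢0 ∘ sym ∷ []) ∷ (x≢-x b≢0 ∷ []) ∷ [] ∷ [])
          (mk⇔ to from)
          where
          to : ∀ {y} → y ∈ 0# ∷ b ∷ - b ∷ [] → τ y ≡ y
          to (here refl)                 = τ0≡0
          to (there (here refl))         = Equivalence.from τ-fixed⇔ (inj₂ bb≡a)
          to (there (there (here refl))) = Equivalence.from τ-fixed⇔ (inj₂ (trans (-x*-y≡x*y b b) bb≡a))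
          from : ∀ {y} → τ y ≡ y → y ∈ 0# ∷ b ∷ - b ∷ []
          from τy≡y with Equivalence.to τ-fixed⇔ τy≡y
          ... | inj₁ y≡0  = here y≡0
          ... | inj₂ yy≡a =
            [ there ∘ here , there ∘ there ∘ here ]′ (square-roots (trans yy≡a (sym bb≡a)))
        ∏unit≡-a : ∏ unit (0# ∷ b ∷ - b ∷ []) ≡ - a
        ∏unit≡-a = begin
          unit 0# * (unit b * (unit (- b) * 1#))
            ≡⟨ cong₂ (λ u v → u * (v * (unit (- b) * 1#)))
                     (select-no (λ 0≢0 → 0≢0 refl) (¬? (0# ≟ 0#)) 0#) (select-yes b≢0 (¬? (b ≟ 0#)) b) ⟩
          1# * (b * (unit (- b) * 1#))  ≡⟨ *-identityˡ _ ⟩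
          b * (unit (- b) * 1#)
            ≡⟨ cong (b *_) (trans (*-identityʳ _) (select-yes -b≢0 (¬? ((- b) ≟ 0#)) (- b))) ⟩
          b * - b                       ≡⟨ -‿distribʳ-* b b ⟨
          - (b * b)                     ≡⟨ cong -_ bb≡a ⟩
          - a                           ∎
        size≡ : size ≡ suc (suc (length moved) ℕ.+ suc (length moved))
        size≡ = begin
          size                                            ≡⟨ size-split fixed↭[0,b,-b] ⟩
          3 ℕ.+ (length moved ℕ.+ length moved)           ≡⟨ cong (suc ∘ suc) (ℕ.+-suc _ _) ⟨
          suc (suc (length moved) ℕ.+ suc (length moved)) ∎

    unit-square : ∃ λ m → size ≡ suc (suc m ℕ.+ suc m) × wilsonProduct ≡ - (1# ^ suc m)
    unit-square = Inversion.wilson-square 1≢0 (*-identityˡ 1#)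

    -- (q − 1)/2: for a = 1 the fixed points of x ↦ a/x are 0, 1 and −1, so q = 3 + 2m.
    half : ℕ
    half = suc (proj₁ unit-square)

    wilson : wilsonProduct ≡ - 1#
    wilson = trans (proj₂ (proj₂ unit-square)) (cong -_ (×-idem (*-identityˡ 1#) half))

    half-unique : ∀ m → size ≡ suc (m ℕ.+ m) → m ≡ half
    half-unique m size≡ = trans (ℕ.n≡⌊n+n/2⌋ m) (trans (cong ℕ.⌊_/2⌋ m+m≡) (sym (ℕ.n≡⌊n+n/2⌋ half)))
      where
      m+m≡ : m ℕ.+ m ≡ half ℕ.+ half
      m+m≡ = ℕ.suc-injective (trans (sym size≡) (proj₁ (proj₂ unit-square)))

    euler-square : ∀ {a} → a ≢ 0# → IsSquare a → a ^ half ≡ 1#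
    euler-square {a} a≢0 sq with Any.satisfied sq
    ... | b , bb≡a with Inversion.wilson-square a≢0 bb≡a
    ...   | m , size≡ , W≡ = ⁻¹-injective (begin
      - (a ^ half)   ≡⟨ cong (λ n → - (a ^ n)) (half-unique (suc m) size≡) ⟨
      - (a ^ suc m)  ≡⟨ W≡ ⟨
      wilsonProduct  ≡⟨ wilson ⟩
      - 1#           ∎)

    euler-¬square : ∀ {a} → a ≢ 0# → ¬ IsSquare a → a ^ half ≡ - 1#
    euler-¬square {a} a≢0 ¬sq with Inversion.wilson-¬square a≢0 ¬sq
    ... | m , size≡ , W≡ = begin
      a ^ half       ≡⟨ cong (a ^_) (half-unique m size≡) ⟨
      a ^ m          ≡⟨ W≡ ⟨
      wilsonProduct  ≡⟨ wilson ⟩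
      - 1#           ∎

    euler-criterion : ∀ {a} → a ≢ 0# → a ^ half ≡ ι (legendre a)
    euler-criterion {a} a≢0 with isSquare? a
    ... | yes sq = trans (euler-square a≢0 sq) (sym (trans (cong ι (legendre-square a≢0 sq)) ι-+1))
    ... | no ¬sq =
      trans (euler-¬square a≢0 ¬sq) (sym (trans (cong ι (legendre-¬square a≢0 ¬sq)) (cong -_ ι-+1)))

    legendre-* : ∀ {a b} → a ≢ 0# → b ≢ 0# → legendre (a * b) ≡ legendre a ℤ.* legendre b
    legendre-* {a} {b} a≢0 b≢0 =
      ι-injective-sign (legendre-sign ab≢0) (IsSign-* (legendre-sign a≢0) (legendre-sign b≢0)) (begin
        ι (legendre (a * b))               ≡⟨ euler-criterion ab≢0 ⟨
        (a * b) ^ half                     ≡⟨ ^-distrib-* a b half ⟩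
        a ^ half * b ^ half                ≡⟨ cong₂ _*_ (euler-criterion a≢0) (euler-criterion b≢0) ⟩
        ι (legendre a) * ι (legendre b)    ≡⟨ ι-*-sign (legendre-sign a≢0) (legendre-sign b≢0) ⟨
        ι (legendre a ℤ.* legendre b)      ∎)
      where
      ab≢0 : a * b ≢ 0#
      ab≢0 = x*y≢0 a≢0 b≢0

2∤odd-prime^n : ∀ {p} → Prime p → p ≢ 2 → ∀ n → ¬ 2 ∣ p ℕ.^ n
2∤odd-prime^n _       _   zero    2∣1 with () ← ∣1⇒≡1 2∣1
2∤odd-prime^n p-prime p≢2 (suc n) 2∣p^[1+n] with euclidsLemma _ _ prime[2] 2∣p^[1+n]
... | inj₂ 2∣p^n = 2∤odd-prime^n p-prime p≢2 n 2∣p^n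
... | inj₁ 2∣p with prime⇒irreducible p-prime 2∣p
...   | inj₁ ()
...   | inj₂ 2≡p = p≢2 (sym 2≡p)

module ProductFormula (F : FiniteField) (2≢0 : FiniteField.2# F ≢ FiniteField.0# F)
                      (j ℓ : FiniteField.Carrier F) (j+ℓ≢0 : FiniteField._+_ F j ℓ ≢ FiniteField.0# F)
                      {μ : ℤ} (μ-sign : IsSign μ) where
  open FiniteField F
  open FiniteFieldProperties F
  open OddCharacteristic 2≢0
  open CommutativeRing commutativeRing using (*-identityʳ)
  open ≡-Reasoning

  InT : Carrier → Carrier → Carrier → Set
  InT j ℓ a = a ≢ 0# × legendre (j - a) ≡ μ × legendre (ℓ + a) ≡ μ

  -- The filter predicate in the definition of T, so T j ℓ μ μ is filter (InT? j ℓ) elements.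
  InT? : ∀ j ℓ a → Dec (InT j ℓ a)
  InT? j ℓ a = ¬? (a ≟ 0#) ×-dec ((legendre (j - a) ℤ.≟ μ) ×-dec (legendre (ℓ + a) ℤ.≟ μ))

  s : Carrier
  s = j + ℓ

  h : Carrier
  h = s * 2# ⁻¹

  SumOfTwo : Carrier → Set
  SumOfTwo x = legendre x ≡ μ × legendre (s - x) ≡ μ

  SumOfTwo? : ∀ x → Dec (SumOfTwo x)
  SumOfTwo? x = (legendre x ℤ.≟ μ) ×-dec (legendre (s - x) ℤ.≟ μ)

  prod-T-swap : prod (T ℓ j μ μ) ≡ ∏ (sign ∘ InT? j ℓ) elements * prod (T j ℓ μ μ)
  prod-T-swap = prod-filter-neg (InT? ℓ j) (InT? j ℓ) λ a → mk⇔
    (λ (-a≢0 , χ[ℓ--a] , χ[j-a]) → -a≢0 ∘ Equivalence.from -x≡0⇔x≡0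
                                 , χ[j-a]
                                 , trans (cong (λ t → legendre (ℓ + t)) (sym (-‿involutive a))) χ[ℓ--a])
    (λ (a≢0 , χ[j-a] , χ[ℓ+a]) → a≢0 ∘ Equivalence.to -x≡0⇔x≡0
                               , trans (cong (λ t → legendre (ℓ + t)) (-‿involutive a)) χ[ℓ+a]
                               , χ[j-a])

  ∏-sign-InT : ∏ (sign ∘ InT? j ℓ) elements ≡ ∏ (λ x → sign (¬? (x ≟ j) ×-dec SumOfTwo? x)) elements
  ∏-sign-InT = trans (ElementsInvolution.∏-reindex (λ x → j - x) (x-[x-y]≡y j) _)
    (∏-cong elements λ {x} _ → sign-cong (reindexed x) (InT? j ℓ (j - x)) (¬? (x ≟ j) ×-dec SumOfTwo? x))
    where
    reindexed : ∀ x → InT j ℓ (j - x) ⇔ (x ≢ j × SumOfTwo x)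
    reindexed x = mk⇔
      (λ (j-x≢0 , χ₁ , χ₂) → j-x≢0 ∘ Equivalence.from x-y≡0⇔x≡y ∘ sym
                           , trans (cong legendre (sym (x-[x-y]≡y j x))) χ₁
                           , trans (cong legendre (sym (x+[y-z]≡[y+x]-z ℓ j x))) χ₂)
      (λ (x≢j , χ₁ , χ₂) → x≢j ∘ sym ∘ Equivalence.to x-y≡0⇔x≡y
                         , trans (cong legendre (x-[x-y]≡y j x)) χ₁
                         , trans (cong legendre (x+[y-z]≡[y+x]-z ℓ j x)) χ₂)

  ∏-sign-SumOfTwo : ∏ (sign ∘ SumOfTwo?) elements ≡ sign (SumOfTwo? h)
  ∏-sign-SumOfTwo = ∏-sign-involution SumOfTwo? (λ x → s - x) (x-[x-y]≡y s)
    (λ x → mk⇔ (λ (χ₁ , χ₂) → trans (cong legendre (sym (x-[x-y]≡y s x))) χ₂ , χ₁)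
               (λ (χ₁ , χ₂) → χ₂ , trans (cong legendre (x-[x-y]≡y s x)) χ₁))
    x-y≡y⇔y≡x*2⁻¹

  prod-T-ratio : prod (T ℓ j μ μ) ≡ (sign (legendre h ℤ.≟ μ) * sign (SumOfTwo? j)) * prod (T j ℓ μ μ)
  prod-T-ratio = trans prod-T-swap (cong (_* prod (T j ℓ μ μ)) (begin
    ∏ (sign ∘ InT? j ℓ) elements                           ≡⟨ ∏-sign-InT ⟩
    ∏ (λ x → sign (¬? (x ≟ j) ×-dec SumOfTwo? x)) elements ≡⟨ ∏-sign-without SumOfTwo? j ⟩
    ∏ (sign ∘ SumOfTwo?) elements * sign (SumOfTwo? j)     ≡⟨ cong (_* sign (SumOfTwo? j)) ∏-sign-SumOfTwo ⟩
    sign (SumOfTwo? h) * sign (SumOfTwo? j)                ≡⟨ cong (_* sign (SumOfTwo? j)) h-sign ⟩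
    sign (legendre h ℤ.≟ μ) * sign (SumOfTwo? j)           ∎))
    where
    h-sign : sign (SumOfTwo? h) ≡ sign (legendre h ℤ.≟ μ)
    h-sign = sign-cong (mk⇔ proj₁ (λ χ → χ , trans (cong legendre s-h≡h) χ))
                       (SumOfTwo? h) (legendre h ℤ.≟ μ)
      where
      s-h≡h : s - h ≡ h
      s-h≡h = Equivalence.from x-y≡y⇔y≡x*2⁻¹ refl

  h≢0 : h ≢ 0#
  h≢0 = x*y≢0 j+ℓ≢0 (x⁻¹≢0 2≢0)

  μ*χ[2]*χ[s]≡μ*χ[h] : μ ℤ.* legendre 2# ℤ.* legendre s ≡ μ ℤ.* legendre h
  μ*χ[2]*χ[s]≡μ*χ[h] = begin
    μ ℤ.* χ[2] ℤ.* legendre s             ≡⟨ cong (μ ℤ.* χ[2] ℤ.*_) χ[s]≡χ[2]*χ[h] ⟩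
    μ ℤ.* χ[2] ℤ.* (χ[2] ℤ.* χ[h])        ≡⟨ ℤ.*-assoc μ χ[2] _ ⟩
    μ ℤ.* (χ[2] ℤ.* (χ[2] ℤ.* χ[h]))      ≡⟨ cong (μ ℤ.*_) (ℤ.*-assoc χ[2] χ[2] χ[h]) ⟨
    μ ℤ.* (χ[2] ℤ.* χ[2] ℤ.* χ[h])
      ≡⟨ cong (λ t → μ ℤ.* (t ℤ.* χ[h])) (IsSign-square (legendre-sign 2≢0)) ⟩
    μ ℤ.* (+ 1 ℤ.* χ[h])                  ≡⟨ cong (μ ℤ.*_) (ℤ.*-identityˡ χ[h]) ⟩
    μ ℤ.* χ[h]                            ∎
    where
    χ[2] χ[h] : ℤ
    χ[2] = legendre 2#
    χ[h] = legendre h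
    χ[s]≡χ[2]*χ[h] : legendre s ≡ χ[2] ℤ.* χ[h]
    χ[s]≡χ[2]*χ[h] = trans (cong legendre (sym (x*[y*x⁻¹]≡y s 2≢0))) (legendre-* 2≢0 h≢0)

  sign-χ[h] : sign (legendre h ℤ.≟ μ) ≡ - ι (μ ℤ.* legendre 2# ℤ.* legendre s)
  sign-χ[h] = trans (sign-≟ μ-sign (legendre-sign h≢0)) (cong (-_ ∘ ι) (sym μ*χ[2]*χ[s]≡μ*χ[h]))

  SumOfTwo-j⇔ : SumOfTwo j ⇔ (legendre j ≡ μ × legendre ℓ ≡ μ)
  SumOfTwo-j⇔ = mk⇔ (λ (χj , χℓ) → χj , trans (cong legendre (sym ([x+y]-x≡y j ℓ))) χℓ)
                     (λ (χj , χℓ) → χj , trans (cong legendre ([x+y]-x≡y j ℓ)) χℓ)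

  both-μ : legendre j ≡ μ × legendre ℓ ≡ μ →
           prod (T ℓ j μ μ) ≡ ι (μ ℤ.* legendre 2# ℤ.* legendre (j + ℓ)) * prod (T j ℓ μ μ)
  both-μ both = trans prod-T-ratio (cong (_* prod (T j ℓ μ μ)) (begin
    sign (legendre h ℤ.≟ μ) * sign (SumOfTwo? j)
      ≡⟨ cong₂ _*_ sign-χ[h] (sign-yes (Equivalence.from SumOfTwo-j⇔ both) (SumOfTwo? j)) ⟩
    - ι c * - 1#                                 ≡⟨ -x*-y≡x*y (ι c) 1# ⟩
    ι c * 1#                                     ≡⟨ *-identityʳ (ι c) ⟩
    ι c                                          ∎))
    where
    c : ℤ
    c = μ ℤ.* legendre 2# ℤ.* legendre s

  not-both-μ : ¬ (legendre j ≡ μ × legendre ℓ ≡ μ) →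
               prod (T ℓ j μ μ) ≡ ι (ℤ.- (μ ℤ.* legendre 2# ℤ.* legendre (j + ℓ))) * prod (T j ℓ μ μ)
  not-both-μ ¬both = trans prod-T-ratio (cong (_* prod (T j ℓ μ μ)) (begin
    sign (legendre h ℤ.≟ μ) * sign (SumOfTwo? j)
      ≡⟨ cong₂ _*_ sign-χ[h] (sign-no (¬both ∘ Equivalence.to SumOfTwo-j⇔) (SumOfTwo? j)) ⟩
    - ι c * 1#                                   ≡⟨ *-identityʳ (- ι c) ⟩
    - ι c                                        ≡⟨ ι-neg c ⟨
    ι (ℤ.- c)                                    ∎))
    where
    c : ℤ
    c = μ ℤ.* legendre 2# ℤ.* legendre s

proposition5p2 : (F : FiniteField) → (p k : ℕ) → Prime p → ¬ (p ≡ 2) →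
    FiniteField.size F ≡ p Data.Nat.^ Data.Nat.suc k →
    (j ℓ : FiniteField.Carrier F) → ¬ (FiniteField._+_ F j ℓ ≡ FiniteField.0# F) →
    (μ : ℤ) → (μ ≡ + 1 ⊎ μ ≡ ℤ.- (+ 1)) →
    let open FiniteField F in
    (legendre j ≡ μ × legendre ℓ ≡ μ →
      prod (T ℓ j μ μ) ≡ ι (μ ℤ.* legendre 2# ℤ.* legendre (j + ℓ)) * prod (T j ℓ μ μ))
    × (¬ (legendre j ≡ μ × legendre ℓ ≡ μ) →
      prod (T ℓ j μ μ) ≡ ι (ℤ.- (μ ℤ.* legendre 2# ℤ.* legendre (j + ℓ))) * prod (T j ℓ μ μ))
proposition5p2 F p k p-prime p≢2 size≡p^[1+k] j ℓ j+ℓ≢0 μ μ-sign =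
  ProductFormula.both-μ F 2≢0 j ℓ j+ℓ≢0 μ-sign , ProductFormula.not-both-μ F 2≢0 j ℓ j+ℓ≢0 μ-sign
  where
  2≢0 : FiniteField.2# F ≢ FiniteField.0# F
  2≢0 2≡0 = 2∤odd-prime^n p-prime p≢2 (suc k)
              (subst (2 ∣_) size≡p^[1+k] (FiniteFieldProperties.2≡0⇒2∣size F 2≡0))
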